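{- Define a sequence $(c_n)_{n\ge 0}$ of real numbers by $c_0=0$, $c_1=1$ and, for all $n\ge0$, $$c_{5n}=c_n,\quad c_{5n+1}=\sqrt3\,c_n+c_{n+1},\quad c_{5n+2}=2c_n+\sqrt3\,c_{n+1},\quad c_{5n+3}=\sqrt3\,c_n+2c_{n+1},\quad c_{5n+4}=c_n+\sqrt3\,c_{n+1}.$$ For $n\ge1$ let $t_n=\dfrac{\sqrt3\, c_{n+1}}{c_n}$. Then every positive rational number equals $t_n$ for some $n\ge 1$.
   Context: All $c_n$ with $n\ge 1$ are positive. -}

module Defs where

open import Data.Nat using (ℕ; zero; suc; _+_; _*_)
open import Data.Nat.DivMod using (_/_; _%_)
open import Data.Product using (_×_; _,_)

-- Elements a + b√3 of ℤ[√3] with a, b ∈ ℕ (all c_n lie in ℕ[√3]).  Since 1 and √3 are linearly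
-- independent over ℚ, equality of such reals is componentwise equality.
Z3 : Set
Z3 = ℕ × ℕ

_⊕_ : Z3 → Z3 → Z3
(a , b) ⊕ (c , d) = (a + c , b + d)

_·_ : ℕ → Z3 → Z3
k · (a , b) = (k * a , k * b)

-- multiplication by √3 :  √3 (a + b√3) = 3b + a√3
r3 : Z3 → Z3
r3 (a , b) = (3 * b , a)

-- c_{5n+k} in terms of x = c_n, y = c_{n+1}
step : ℕ → Z3 → Z3 → Z3
step 0 x y = x
step 1 x y = r3 x ⊕ y
step 2 x y = (2 · x) ⊕ r3 y
step 3 x y = r3 x ⊕ (2 · y)
step _ x y = x ⊕ r3 y

-- fuel-based recursion; fuel (suc m) suffices for index m since
-- for m ≥ 2 both m / 5 and m / 5 + 1 are < m.
cF : ℕ → ℕ → Z3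
cF zero _ = (0 , 0)
cF (suc f) zero = (0 , 0)
cF (suc f) (suc zero) = (1 , 0)
cF (suc f) m@(suc (suc _)) = step (m % 5) (cF f (m / 5)) (cF f (suc (m / 5)))

c : ℕ → Z3
c m = cF (suc m) m

module Submission where

-- Writing t(x, y) = √3 y / x, the recurrences give t_{5n+k} = μ_k(t_n) for n ≥ 1, where
--   μ₀(t) = t + 3,  μ₁(t) = 3(t + 2)/(t + 3),  μ₂(t) = (2t + 3)/(t + 2),
--   μ₃(t) = 3(t + 1)/(2t + 3),  μ₄(t) = t/(t + 1).
-- These maps send (0, ∞) onto (3, ∞), (2, 3), (3/2, 2), (1, 3/2) and (0, 1), while
-- t₁ = 3, t₂ = 2, t₃ = 3/2 and t₄ = 1 fill the gaps.  Inverting the relevant μ_k on a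
-- fraction p/q strictly decreases p + q, so every positive fraction is reached by descent.

open import Defs
open import Data.Nat
open import Data.Nat.Properties
open import Data.Nat.DivMod
open import Data.Nat.Divisibility using (divides-refl)
open import Data.Nat.Induction using (<-wellFounded)
open import Data.Nat.Tactic.RingSolver
open import Data.List using (_∷_; [])
open import Data.Product using (Σ; _×_; _,_; proj₁; proj₂)
open import Function using (_∘_; _$_)
open import Induction.WellFounded using (Acc; acc)
open import Relation.Binary.PropositionalEquality

[k+m*n]%n≡k : ∀ {k} m n .{{_ : NonZero n}} → k < n → (k + m * n) % n ≡ k
[k+m*n]%n≡k {k} m n k<n = trans ([m+kn]%n≡m%n k m n) (m<n⇒m%n≡m k<n)

[k+m*n]/n≡m : ∀ {k} m n .{{_ : NonZero n}} → k < n → (k + m * n) / n ≡ m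
[k+m*n]/n≡m {k} m n k<n =
  trans (+-distrib-/-∣ʳ k (divides-refl m)) (cong₂ _+_ (m<n⇒m/n≡0 k<n) (m*n/n≡m m n))

suc[n/5]<n : ∀ {n} → n ≥ 2 → suc (n / 5) < n
suc[n/5]<n {suc (suc k)} (s≤s (s≤s _)) =
  s≤s (m<n*o⇒m/o<n (s≤s (s≤s (s≤s (≤-trans (m≤m*n k 5) (m≤n+m (k * 5) 2))))))

cF-fuel : ∀ {f g} m → m < f → m < g → cF f m ≡ cF g m
cF-fuel {suc f} {suc g} zero _ _ = refl
cF-fuel {suc f} {suc g} (suc zero) _ _ = refl
cF-fuel {suc f} {suc g} (suc (suc k)) (s≤s m≤f) (s≤s m≤g) =
  cong₂ (step _) (cF-fuel _ (<-trans (n<1+n _) q+1<f) (<-trans (n<1+n _) q+1<g))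
                 (cF-fuel _ q+1<f q+1<g)
  where
  q+1<f : suc ((2 + k) / 5) < f
  q+1<f = <-≤-trans (suc[n/5]<n (s≤s (s≤s z≤n))) m≤f
  q+1<g : suc ((2 + k) / 5) < g
  q+1<g = <-≤-trans (suc[n/5]<n (s≤s (s≤s z≤n))) m≤g

c-unfold : ∀ n → n ≥ 2 → c n ≡ step (n % 5) (c (n / 5)) (c (suc (n / 5)))
c-unfold (suc (suc k)) n≥2@(s≤s (s≤s _)) =
  cong₂ (step _) (cF-fuel _ (<-trans (n<1+n _) q+1<n) ≤-refl) (cF-fuel _ q+1<n ≤-refl)
  where
  q+1<n : suc ((2 + k) / 5) < 2 + k
  q+1<n = suc[n/5]<n n≥2

c-digit : ∀ m k → k < 5 → c (k + suc m * 5) ≡ step k (c (suc m)) (c (2 + m))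
c-digit m k k<5 = trans (c-unfold (k + suc m * 5) (≤-trans (s≤s (s≤s z≤n)) (m≤n+m _ k)))
  (cong₂ (λ r q → step r (c q) (c (suc q))) ([k+m*n]%n≡k (suc m) 5 k<5) ([k+m*n]/n≡m (suc m) 5 k<5))

-- Ratio p q x y says √3 y / x = p / q; thus Ratio p q (c n) (c (suc n)) says t_n = p / q.
record Ratio (p q : ℕ) (x y : Z3) : Set where
  constructor ratio
  field
    equation : q · r3 y ≡ p · x

·-assoc : ∀ k l x → (k * l) · x ≡ k · (l · x)
·-assoc k l (a , b) = cong₂ _,_ (*-assoc k l a) (*-assoc k l b)

·-cancelˡ : ∀ k .{{_ : NonZero k}} {x y} → k · x ≡ k · y → x ≡ y
·-cancelˡ k {a , b} {e , f} eq =
  cong₂ _,_ (*-cancelˡ-≡ a e k (cong proj₁ eq)) (*-cancelˡ-≡ b f k (cong proj₂ eq))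

ratio-scale : ∀ {p q x y} k → Ratio p q x y → Ratio (k * p) (k * q) x y
ratio-scale {p} {q} {x} {y} k (ratio r) = ratio $ begin
  (k * q) · r3 y  ≡⟨ ·-assoc k q (r3 y) ⟩
  k · (q · r3 y)  ≡⟨ cong (k ·_) r ⟩
  k · (p · x)     ≡⟨ ·-assoc k p x ⟨
  (k * p) · x     ∎
  where open ≡-Reasoning

ratio-cancel : ∀ {p q x y} k .{{_ : NonZero k}} → Ratio (k * p) (k * q) x y → Ratio p q x y
ratio-cancel {p} {q} {x} {y} k (ratio r) =
  ratio (·-cancelˡ k (trans (sym (·-assoc k q (r3 y))) (trans r (·-assoc k p x))))

cancel-by : ∀ {L R u v} → v ≡ u → L + u ≡ R + v → L ≡ R
cancel-by {L} {R} {u} v≡u eq = +-cancelʳ-≡ u L R (trans eq (cong (R +_) v≡u))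

-- With x = a + b√3 and y = e + f√3, the defect p x - q √3 y of the conclusion is 1 or √3
-- times that of the hypothesis, so each component (rational part, √3-part) of the
-- conclusion is a ring identity plus one component of the hypothesis, tripled when the
-- factor √3 swaps them.
ratio-digit0 : ∀ {p q x y} → Ratio p q x y → Ratio (p + 3 * q) q (step 0 x y) (step 1 x y)
ratio-digit0 {p} {q} {a , b} {e , f} (ratio r) = ratio $
  cong₂ _,_ (cancel-by (cong proj₁ r) (rational p q a f)) (cancel-by (cong proj₂ r) (irrational p q b e))
  where
  rational : ∀ p q a f → q * (3 * (a + f)) + p * a ≡ (p + 3 * q) * a + q * (3 * f)
  rational = solve-∀
  irrational : ∀ p q b e → q * (3 * b + e) + p * b ≡ (p + 3 * q) * b + q * e
  irrational = solve-∀

ratio-digit1 : ∀ {p q x y} → Ratio p q x y →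
               Ratio (3 * p + 6 * q) (p + 3 * q) (step 1 x y) (step 2 x y)
ratio-digit1 {p} {q} {a , b} {e , f} (ratio r) = ratio $
  cong₂ _,_ (cancel-by (cong ((3 *_) ∘ proj₂) r) (rational p q b e))
            (cancel-by (cong proj₁ r) (irrational p q a f))
  where
  rational : ∀ p q b e →
    (p + 3 * q) * (3 * (2 * b + e)) + 3 * (p * b) ≡ (3 * p + 6 * q) * (3 * b + e) + 3 * (q * e)
  rational = solve-∀
  irrational : ∀ p q a f →
    (p + 3 * q) * (2 * a + 3 * f) + p * a ≡ (3 * p + 6 * q) * (a + f) + q * (3 * f)
  irrational = solve-∀

ratio-digit2 : ∀ {p q x y} → Ratio p q x y →
               Ratio (2 * p + 3 * q) (p + 2 * q) (step 2 x y) (step 3 x y)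
ratio-digit2 {p} {q} {a , b} {e , f} (ratio r) = ratio $
  cong₂ _,_ (cancel-by (cong proj₁ r) (rational p q a f)) (cancel-by (cong proj₂ r) (irrational p q b e))
  where
  rational : ∀ p q a f →
    (p + 2 * q) * (3 * (a + 2 * f)) + p * a ≡ (2 * p + 3 * q) * (2 * a + 3 * f) + q * (3 * f)
  rational = solve-∀
  irrational : ∀ p q b e →
    (p + 2 * q) * (3 * b + 2 * e) + p * b ≡ (2 * p + 3 * q) * (2 * b + e) + q * e
  irrational = solve-∀

ratio-digit3 : ∀ {p q x y} → Ratio p q x y →
               Ratio (3 * p + 3 * q) (2 * p + 3 * q) (step 3 x y) (step 4 x y)
ratio-digit3 {p} {q} {a , b} {e , f} (ratio r) = ratio $
  cong₂ _,_ (cancel-by (cong ((3 *_) ∘ proj₂) r) (rational p q b e))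
            (cancel-by (cong proj₁ r) (irrational p q a f))
  where
  rational : ∀ p q b e →
    (2 * p + 3 * q) * (3 * (b + e)) + 3 * (p * b) ≡ (3 * p + 3 * q) * (3 * b + 2 * e) + 3 * (q * e)
  rational = solve-∀
  irrational : ∀ p q a f →
    (2 * p + 3 * q) * (a + 3 * f) + p * a ≡ (3 * p + 3 * q) * (a + 2 * f) + q * (3 * f)
  irrational = solve-∀

ratio-digit4 : ∀ {p q x y} → Ratio p q x y → Ratio p (p + q) (step 4 x y) y
ratio-digit4 {p} {q} {a , b} {e , f} (ratio r) = ratio $
  cong₂ _,_ (cancel-by (cong proj₁ r) (rational p q a f)) (cancel-by (cong proj₂ r) (irrational p q b e))
  where
  rational : ∀ p q a f → (p + q) * (3 * f) + p * a ≡ p * (a + 3 * f) + q * (3 * f)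
  rational = solve-∀
  irrational : ∀ p q b e → (p + q) * e + p * b ≡ p * (b + e) + q * e
  irrational = solve-∀

t₁≡3 : Ratio 3 1 (c 1) (c 2)
t₁≡3 = ratio refl

t₂≡2 : Ratio 2 1 (c 2) (c 3)
t₂≡2 = ratio refl

t₃≡3/2 : Ratio 3 2 (c 3) (c 4)
t₃≡3/2 = ratio refl

t₄≡1 : Ratio 1 1 (c 4) (c 5)
t₄≡1 = ratio refl

record Attained (p q : ℕ) : Set where
  constructor attained
  field
    index : ℕ
    index≥1 : index ≥ 1
    at-index : Ratio p q (c index) (c (suc index))

attained-≡ : ∀ {p q P Q} → Attained p q → p ≡ P → q ≡ Q → Attained P Q
attained-≡ t refl refl = t

attained-scale : ∀ {p q} k → Attained p q → Attained (k * p) (k * q)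
attained-scale k (attained n n≥1 r) = attained n n≥1 (ratio-scale k r)

attained-cancel : ∀ {p q} k .{{_ : NonZero k}} → Attained (k * p) (k * q) → Attained p q
attained-cancel k (attained n n≥1 r) = attained n n≥1 (ratio-cancel k r)

attained-digit : ∀ {p q p′ q′} k → k < 4 →
  (∀ {x y} → Ratio p q x y → Ratio p′ q′ (step k x y) (step (suc k) x y)) →
  Attained p q → Attained p′ q′
attained-digit {p′ = p′} {q′} k k<4 ratio-step (attained (suc m) _ r) =
  attained (k + suc m * 5) (≤-trans z<s (m≤n+m _ k))
    (subst₂ (Ratio p′ q′) (sym (c-digit m k (m<n⇒m<1+n k<4))) (sym (c-digit m (suc k) (s<s k<4)))
      (ratio-step r))

attained-digit4 : ∀ {p q} → Attained p q → Attained p (p + q)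
attained-digit4 {p} {q} (attained (suc m) _ r) =
  attained (4 + suc m * 5) z<s
    (subst₂ (Ratio p (p + q)) (sym (c-digit m 4 ≤-refl)) (sym (c-digit (suc m) 0 z<s)) (ratio-digit4 r))

-- The decrease a′ + b′ < a + b is stated with an explicit slack d, so that the ring
-- solver can certify it.
AttainedBelow : ℕ → ℕ → Set
AttainedBelow a b = ∀ a′ b′ d → suc (a′ + b′ + d) ≡ a + b → Attained (suc a′) (suc b′)

descent : ∀ a b → AttainedBelow a b → Attained (suc a) (suc b)
descent a b IH with compare a b
... | less a k =
  attained-≡ (attained-digit4 (IH a k a (solve (a ∷ k ∷ [])))) refl (solve (a ∷ k ∷ []))
... | equal a =
  attained-≡ (attained-scale (suc a) (attained 4 z<s t₄≡1)) (solve (a ∷ [])) (solve (a ∷ []))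
... | greater b k with compare k b
...   | equal k =
  attained-≡ (attained-scale (suc k) (attained 2 z<s t₂≡2)) (solve (k ∷ [])) (solve (k ∷ []))
...   | less k i with compare k i
...     | less k j =
  attained-cancel 3 (attained-≡
    (attained-digit 3 (s<s (s<s (s<s z<s))) ratio-digit3
      (IH (2 + 3 * k) j (2 + 2 * k + j) (solve (k ∷ j ∷ []))))
    (solve (k ∷ j ∷ [])) (solve (k ∷ j ∷ [])))
...     | equal k =
  attained-≡ (attained-scale (suc k) (attained 3 z<s t₃≡3/2)) (solve (k ∷ [])) (solve (k ∷ []))
...     | greater i j =
  attained-≡
    (attained-digit 2 (s<s (s<s z<s)) ratio-digit2 (IH j i (5 + 4 * i + 2 * j) (solve (i ∷ j ∷ []))))
    (solve (i ∷ j ∷ [])) (solve (i ∷ j ∷ []))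
descent _ _ IH | greater b _ | greater _ i with compare i b
...     | less i j =
  attained-cancel 3 (attained-≡
    (attained-digit 1 (s<s z<s) ratio-digit1 (IH (2 + 3 * i) j (2 + i + 2 * j) (solve (i ∷ j ∷ []))))
    (solve (i ∷ j ∷ [])) (solve (i ∷ j ∷ [])))
...     | equal i =
  attained-≡ (attained-scale (suc i) (attained 1 z<s t₁≡3)) (solve (i ∷ [])) (solve (i ∷ []))
...     | greater b j =
  attained-≡ (attained-digit 0 z<s ratio-digit0 (IH j b (2 + 3 * b) (solve (b ∷ j ∷ []))))
    (solve (b ∷ j ∷ [])) refl

attained-positive : ∀ a b → Acc _<_ (a + b) → Attained (suc a) (suc b)
attained-positive a b (acc rs) = descent a b λ a′ b′ d eq →
  attained-positive a′ b′ (rs (subst (suc (a′ + b′) ≤_) eq (s≤s (m≤m+n (a′ + b′) d))))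

theorem4 : (p q : ℕ) → p ≥ 1 → q ≥ 1 →
    Σ ℕ (λ n → n ≥ 1 × (q · r3 (c (suc n)) ≡ p · c n))
theorem4 (suc a) (suc b) _ _ = index , index≥1 , Ratio.equation at-index
  where open Attained (attained-positive a b (<-wellFounded (a + b)))
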